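{- Let $(X,A_\tau,\rightarrow)$ be a labelled transition system. For all states $s,t$: if $s\mathrel{\#_w} t$ then $s\mathrel{\#_b} t$.
   Context: An LTS is a triple $(X,A_\tau,\rightarrow)$ with $X$ a set of states, $A_\tau=A\cup\{\tau\}$ where $\tau\notin A$ is the silent action, and $\rightarrow\subseteq X\times A_\tau\times X$; write $q\rightarrow_u q'$ for $(q,u,q')\in\rightarrow$. The letter $a$ ranges over $A$. $\twoheadrightarrow_\tau$ is the reflexive-transitive closure of $\rightarrow_\tau$. A relation $Q\subseteq X\times X$ is a weak apartness if: (symm) $Q(p,q)\Rightarrow Q(q,p)$; (in$_{w\tau}$) if $q\rightarrow_\tau q'$ and $Q(q',p')$ for all $p'$ with $p\twoheadrightarrow_\tau p'$, then $Q(q,p)$; (in$_w$) for each $a\in A$: if $q\rightarrow_a q'$ and $Q(q',p''')$ for all $p',p'',p'''$ with $p\twoheadrightarrow_\tau p'\rightarrow_a p''\twoheadrightarrow_\tau p'''$, then $Q(q,p)$. $Q$ is a branching apartness if it satisfies (symm) and: (in$_{b\tau}$) if $q\rightarrow_\tau q'$, $Q(q',p)$, and for all $p',p''$ with $p\twoheadrightarrow_\tau p'\rightarrow_\tau p''$ we have $Q(q,p')\vee Q(q',p'')$, then $Q(q,p)$; (in$_b$) for each $a\in A$: if $q\rightarrow_a q'$ and for all $p',p''$ with $p\twoheadrightarrow_\tau p'\rightarrow_a p''$ we have $Q(q,p')\vee Q(q',p'')$, then $Q(q,p)$. $q\mathrel{\#_w}p$ (resp. $q\mathrel{\#_b}p$)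 means $Q(q,p)$ for every weak (resp. branching) apartness $Q$. -}

module Defs where

open import Data.Maybe using (Maybe; just; nothing)
open import Data.Product using (_×_)
open import Data.Sum using (_⊎_)
open import Relation.Binary.Construct.Closure.ReflexiveTransitive using (Star)

-- A labelled transition system (X, A_τ, →).  Labels in A_τ = A ∪ {τ} are
-- represented as  Maybe A :  nothing = τ (silent), just a = visible a ∈ A.
record LTS : Set₁ where
  field
    X    : Set
    A    : Set
    _⟶[_]_ : X → Maybe A → X → Set

module _ (L : LTS) where
  open LTS L

  _⟶τ_ : X → X → Set
  q ⟶τ q' = q ⟶[ nothing ] q'

  _↠τ_ : X → X → Set
  _↠τ_ = Star _⟶τ_

  Symm : (X → X → Set) → Set
  Symm Q = ∀ {p q} → Q p q → Q q p

  InWτ : (X → X → Set) → Set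
  InWτ Q = ∀ {q q' p} → q ⟶τ q' → (∀ {p'} → p ↠τ p' → Q q' p') → Q q p

  InW : (X → X → Set) → Set
  InW Q = ∀ {a q q' p} → q ⟶[ just a ] q' →
          (∀ {p' p'' p'''} → p ↠τ p' → p' ⟶[ just a ] p'' → p'' ↠τ p''' → Q q' p''') →
          Q q p

  record IsWeakApartness (Q : X → X → Set) : Set where
    field
      symm  : Symm Q
      in-wτ : InWτ Q
      in-w  : InW Q

  InBτ : (X → X → Set) → Set
  InBτ Q = ∀ {q q' p} → q ⟶τ q' → Q q' p →
           (∀ {p' p''} → p ↠τ p' → p' ⟶τ p'' → Q q p' ⊎ Q q' p'') →
           Q q p

  InB : (X → X → Set) → Set
  InB Q = ∀ {a q q' p} → q ⟶[ just a ] q' →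
          (∀ {p' p''} → p ↠τ p' → p' ⟶[ just a ] p'' → Q q p' ⊎ Q q' p'') →
          Q q p

  record IsBranchingApartness (Q : X → X → Set) : Set where
    field
      symm  : Symm Q
      in-bτ : InBτ Q
      in-b  : InB Q

  _#w_ : X → X → Set₁
  q #w p = ∀ (Q : X → X → Set) → IsWeakApartness Q → Q q p

  _#b_ : X → X → Set₁
  q #b p = ∀ (Q : X → X → Set) → IsBranchingApartness Q → Q q p

module Submission where

open import Defs
open import Data.Sum using (inj₂)
open import Relation.Binary.Construct.Closure.ReflexiveTransitive using (ε; _◅_; _◅◅_)

-- Every branching apartness is a weak apartness: in each branching rule the
-- disjunction may always be discharged by its right disjunct, which the weak
-- premise supplies.  Hence #w, quantifying over more relations, implies #b.

module _ (L : LTS) where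
  open LTS L

  InBτ⇒InWτ : ∀ {Q} → InBτ L Q → InWτ L Q
  InBτ⇒InWτ in-bτ q⟶q' apart =
    in-bτ q⟶q' (apart ε) (λ p↠p' p'⟶p'' → inj₂ (apart (p↠p' ◅◅ (p'⟶p'' ◅ ε))))

  InB⇒InW : ∀ {Q} → InB L Q → InW L Q
  InB⇒InW in-b q⟶q' apart = in-b q⟶q' (λ p↠p' p'⟶p'' → inj₂ (apart p↠p' p'⟶p'' ε))

  isBranching⇒isWeak : ∀ {Q} → IsBranchingApartness L Q → IsWeakApartness L Q
  isBranching⇒isWeak B = record
    { symm  = symm
    ; in-wτ = InBτ⇒InWτ in-bτ
    ; in-w  = InB⇒InW in-b
    }
    where open IsBranchingApartness B

lemma3p12 : (L : LTS) → ∀ (s t : LTS.X L) → _#w_ L s t → _#b_ L s t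
lemma3p12 L s t s#wt Q isBranching = s#wt Q (isBranching⇒isWeak L isBranching)
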